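{- Let $G_1,\dots,G_t$ be connected grid graphs, each with exactly $n$ vertices. Then at least one of $G_1,\dots,G_t$ has a Hamiltonian cycle if and only if $\mathsf{HamToSna}(G_1,\dots,G_t)=\langle G,n,\mathsf{init},\mathsf{fin}\rangle$ is a Yes-instance of Snake Game.
   Context: A grid graph is a finite undirected graph $G$ with $V(G)\subseteq\{(i,j):i,j\in\mathbb{N}_0\}$ and $\{(i,j),(i',j')\}\in E(G)$ iff $|i-i'|+|j-j'|=1$. Snake Game: for an undirected graph $G$ and $k\in\mathbb{N}$, a configuration is a tuple $(v_1,\dots,v_k)$ of pairwise distinct vertices with $\{v_i,v_{i+1}\}\in E(G)$; $((v_1,\dots,v_k),(v'_1,\dots,v'_k))$ is a $1$-transition if $v'_1\ne v_i$ for $1\le i\le k-1$ and $v'_i=v_{i-1}$ for $2\le i\le k$; $\langle G,k,\mathsf{init},\mathsf{fin}\rangle$ is a Yes-instance iff there is a sequence $\mathsf{init}=\mathsf{conf}_1,\dots,\mathsf{conf}_{\ell+1}=\mathsf{fin}$ ($\ell\ge1$) of configurations with each consecutive pair a $1$-transition. Construction $\mathsf{HamToSna}(G_1,\dots,G_t)$: for each $i$, let $\hat r^i$ (resp. $\hat c^i$) be the minimum first (resp. second) coordinate of a vertex of $G_i$, and replace every vertex $(a,b)$ of $G_i$ by $(a-\hat r^i+(n+1),\,b-\hat c^i+i(n+1))$ (call the translated graph again $G_i$). Choose arbitrarily a vertex of $G_i$ with first coordinate $n+1$ and denote it $(n+1,c_i)$. Let $V(G)=V^{1}\cup V^{2}\cup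 V^{3}$ with $V^{1}=\{(n-1,j):0\le j\le n-1\}\cup\{(i,n-2):0\le i\le n-1\}$, $V^{2}=\{(n-1,j):n\le j\le c_t\}\cup\{(n,c_i):1\le i\le t\}$, $V^{3}=\bigcup_{i=1}^tV(G_i)$; $E(G)$ consists of all pairs of vertices of $V(G)$ at $\ell_1$-distance $1$. The snake size is $n$, $\mathsf{init}=((n-1,n-1),(n-1,n-2),\dots,(n-1,0))$ and $\mathsf{fin}=((0,n-2),(1,n-2),\dots,(n-1,n-2))$. -}

module Defs where

open import Data.Nat using (ℕ; zero; suc; _+_; _*_; _∸_; _≤_; _<_; _⊓_; ∣_-_∣)
open import Data.Product using (Σ; ∃; ∃-syntax; _×_; _,_; proj₁; proj₂)
open import Data.Sum using (_⊎_)
open import Data.Fin using (Fin; toℕ; fromℕ)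
open import Data.List using (List; []; _∷_; _++_; [_]; map; length; upTo; downFrom)
open import Data.List.Membership.Propositional using (_∈_; _∉_)
open import Data.List.Relation.Unary.All using (All)
open import Data.List.Relation.Unary.AllPairs using (AllPairs)
open import Data.List.Relation.Unary.Unique.Propositional using (Unique)
open import Data.List.Relation.Unary.Linked using (Linked)
open import Relation.Binary.PropositionalEquality using (_≡_; _≢_)
open import Relation.Binary.Construct.Closure.ReflexiveTransitive using (Star)
open import Relation.Binary.Construct.Closure.Transitive using (TransClosure)

Pt : Set
Pt = ℕ × ℕ

Adj : Pt → Pt → Set
Adj (i , j) (i' , j') = ∣ i - i' ∣ + ∣ j - j' ∣ ≡ 1

-- A grid graph is given by its (finite) vertex list; edges are all
-- pairs of vertices at ℓ₁-distance 1.

GridEdge : List Pt → Pt → Pt → Set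
GridEdge V u v = u ∈ V × v ∈ V × Adj u v

Connected : List Pt → Set
Connected V = ∀ u v → u ∈ V → v ∈ V → Star (GridEdge V) u v

HasHamCycle : List Pt → Set
HasHamCycle V =
  ∃[ x ] ∃[ xs ]
    ( 3 ≤ length (x ∷ xs)
    × AllPairs _≢_ (x ∷ xs)
    × All (_∈ V) (x ∷ xs)
    × (∀ v → v ∈ V → v ∈ x ∷ xs)
    × Linked (GridEdge V) ((x ∷ xs) ++ [ x ]))

dropLast : {A : Set} → List A → List A
dropLast []           = []
dropLast (x ∷ [])     = []
dropLast (x ∷ y ∷ xs) = x ∷ dropLast (y ∷ xs)

module _ {A : Set} (Vx : A → Set) (E : A → A → Set) (k : ℕ) where

  IsConfig : List A → Set
  IsConfig c = length c ≡ k × All Vx c × AllPairs _≢_ c × Linked E c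

  OneTransition : List A → List A → Set
  OneTransition c c' =
    IsConfig c × IsConfig c' ×
    (∃[ h ] (c' ≡ h ∷ dropLast c × h ∉ dropLast c))

  YesInstance : List A → List A → Set
  YesInstance init fin = TransClosure OneTransition init fin

-- The construction HamToSna(G₁,…,G_t); graphs indexed by Fin t,
-- graph number i (0-based Fin) is G_{toℕ i + 1}.

minL : List ℕ → ℕ
minL []           = 0
minL (x ∷ [])     = x
minL (x ∷ y ∷ xs) = x ⊓ minL (y ∷ xs)

rHat cHat : List Pt → ℕ
rHat V = minL (map proj₁ V)
cHat V = minL (map proj₂ V)

translate : (n i : ℕ) → List Pt → List Pt
translate n i V =
  map (λ p → (proj₁ p ∸ rHat V + suc n , proj₂ p ∸ cHat V + i * suc n)) V

-- value at the last index t-1 (i.e. c_t); 0 if t = 0 (never used: t ≥ 1)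
lastOf : (t : ℕ) → (Fin t → ℕ) → ℕ
lastOf zero    _ = 0
lastOf (suc s) f = f (fromℕ s)

module HamToSna (n t : ℕ) (Gs : Fin t → List Pt) (c : Fin t → ℕ) where

  G' : Fin t → List Pt
  G' j = translate n (suc (toℕ j)) (Gs j)

  cLast : ℕ
  cLast = lastOf t c

  V1 V2 V3 VG : Pt → Set
  V1 (x , y) = (x ≡ n ∸ 1 × y < n) ⊎ (x < n × y ≡ n ∸ 2)
  V2 (x , y) = (x ≡ n ∸ 1 × n ≤ y × y ≤ cLast) ⊎ (∃[ j ] ((x , y) ≡ (n , c j)))
  V3 p       = ∃[ j ] (p ∈ G' j)
  VG p       = V1 p ⊎ V2 p ⊎ V3 p

  EG : Pt → Pt → Set
  EG u v = VG u × VG v × Adj u v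

  init fin : List Pt
  init = map (λ j → (n ∸ 1 , j)) (downFrom n)
  fin  = map (λ i → (i , n ∸ 2)) (upTo n)

  IsYes : Set
  IsYes = YesInstance VG EG n init fin

-- A connected grid graph on n vertices spans at most n columns
-- (ColumnSpan), so the translated copies G'_i lie below row n, each within n columns and
-- pairwise at least two columns apart.  Copy i is reached from the track (row n - 1)
-- only through the gate (n , c_i) above its entry (n + 1 , c_i).
--
-- (⇒) A snake of length K + 1 can follow its head along any walk in which every vertex
-- differs from the K vertices visited just before it (module Sliding).  From a
-- Hamiltonian cycle of G_i (translated by Translation, rotated to start at entry i) we
-- build such a walk in G: right along the track to gate i, once around the cycle, back
-- left along the track and up the exit column n - 2 into fin (module Tour).
--
-- (⇐) Every configuration reachable from init is in one of four phases (data Phase): on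
-- the track heading right, at a gate, partly inside a copy G'_i, or wholly inside G'_i
-- with its tail at entry i.  Each move keeps the snake in a phase, except that a move
-- from the last phase must go onto the tail, which by pigeonhole closes a Hamiltonian
-- cycle of G'_i, hence of G_i.  fin is in no phase (its head is in row 0).

module Submission where

open import Defs
open import Data.Nat using (ℕ; _≟_; zero; suc; _+_; _*_; _∸_; _≤_; _<_; z≤n; s≤s; ∣_-_∣; _≤?_)
open import Data.Nat.Properties using
  ( ≤-refl; ≤-trans; ≤-antisym; ≤-reflexive; ≤-pred; <⇒≤; <⇒≢; ≰⇒>; <-irrefl; <-cmp; 1+n≰n
  ; n≤1+n; m≤m+n; m≤n+m; m≤n⇒m<n∨m≡n; suc-injective; +-comm; +-suc; +-identityʳ
  ; +-monoʳ-≤; +-monoˡ-≤; *-monoˡ-≤; +-cancelʳ-≡; m+[n∸m]≡n; m+n∸n≡m; m∸n+n≡m; m∸n≤m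
  ; m∸[m∸n]≡n; ∸-+-assoc; m⊓n≤m; m⊓n≤n; ⊓-sel; m≤n⇒m⊓n≡m
  ; ∣n-n∣≡0; ∣-∣-comm; ∣m-n∣≡0⇒m≡n; ∣m+n-m+o∣≡∣n-o∣ )
open import Data.Product using (_×_; _,_; proj₁; proj₂; ∃-syntax; swap)
open import Data.Product.Properties using (≡-dec)
open import Data.Fin using (Fin; toℕ; fromℕ)
open import Data.Fin.Properties using (toℕ-injective; toℕ≤pred[n]; toℕ-fromℕ)
open import Data.Unit using (⊤; tt)
open import Data.Sum using (_⊎_; inj₁; inj₂)
open import Data.Empty using (⊥-elim)
open import Data.List using (List; []; _∷_; _++_; [_]; length; take; map; downFrom; applyUpTo)
open import Data.List.Properties using
  ( ++-identityʳ; ++-assoc; length-take; length-++-≤ʳ; length-++-comm; length-map; map-++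
  ; map-∘; map-id-local; applyUpTo-∷ʳ; map-upTo; length-applyUpTo; length-downFrom; take-all )
open import Data.List.Membership.Propositional using (_∈_; _∉_)
open import Data.List.Membership.Propositional.Properties using (∈-++⁻; ∈-++⁺ʳ; ∈-map⁺; ∈-map⁻; ∈-∃++)
import Data.List.Membership.DecPropositional as DecMembership
open import Data.List.Relation.Unary.Any using (here; there)
open import Data.List.Relation.Unary.All as All using (All; []; _∷_)
open import Data.List.Relation.Unary.All.Properties using (¬Any⇒All¬; All¬⇒¬Any; All-swap)
  renaming ( ++⁺ to All-++⁺; ++⁻ to All-++⁻; map⁺ to All-map⁺
           ; applyUpTo⁺₁ to All-applyUpTo⁺₁; applyUpTo⁺₂ to All-applyUpTo⁺₂ )
open import Data.List.Relation.Unary.AllPairs as AllPairs using ([]; _∷_)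
import Data.List.Relation.Unary.AllPairs.Properties as AllPairsₚ
open import Data.List.Relation.Unary.Linked as Linked using (Linked; []; [-]; _∷_)
open import Data.List.Relation.Unary.Linked.Properties using ()
  renaming (map⁺ to Linked-map⁺; applyUpTo⁺₂ to Linked-applyUpTo⁺₂)
open import Data.List.Relation.Unary.Unique.Propositional using (Unique)
import Data.List.Relation.Unary.Unique.Propositional.Properties as Unique
open import Function using (_∘_)
open import Function.Bundles using (_⇔_; mk⇔)
open import Relation.Nullary using (¬_; yes; no)
open import Relation.Binary.Definitions using (DecidableEquality; tri<; tri≈; tri>)
open import Relation.Binary.PropositionalEquality
  using (_≡_; _≢_; refl; sym; trans; cong; cong₂; subst; subst₂; ≢-sym; module ≡-Reasoning)
open import Relation.Binary.Construct.Closure.ReflexiveTransitive using (Star; ε; _◅_)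
open import Relation.Binary.Construct.Closure.Transitive using (_∷ʳ_)
  renaming ([_] to [_]⁺; _∷_ to _∷⁺_)

private variable
  A : Set

remove : {x : A} (xs : List A) → x ∈ xs → List A
remove (_ ∷ ys) (here _)  = ys
remove (y ∷ ys) (there p) = y ∷ remove ys p

length-remove : {x : A} (xs : List A) (p : x ∈ xs) → suc (length (remove xs p)) ≡ length xs
length-remove (_ ∷ ys) (here _)  = refl
length-remove (_ ∷ ys) (there p) = cong suc (length-remove ys p)

∈-remove : {x y : A} (xs : List A) (p : x ∈ xs) → y ∈ xs → y ≢ x → y ∈ remove xs p
∈-remove (_ ∷ _)  (here refl) (here refl) y≢x = ⊥-elim (y≢x refl)
∈-remove (_ ∷ _)  (here refl) (there q)   _   = q
∈-remove (_ ∷ _)  (there p)   (here refl) _   = here refl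
∈-remove (_ ∷ zs) (there p)   (there q)   y≢x = there (∈-remove zs p q y≢x)

unique-length≤ : {xs ys : List A} → Unique xs → All (_∈ ys) xs → length xs ≤ length ys
unique-length≤ {xs = []}     []          []           = z≤n
unique-length≤ {xs = x ∷ xs} {ys} (x∉xs ∷ u) (x∈ys ∷ xs⊆ys) =
  subst (suc (length xs) ≤_) (length-remove ys x∈ys)
    (s≤s (unique-length≤ u (All.zipWith (λ (x≢z , z∈ys) → stillIn x≢z z∈ys) (x∉xs , xs⊆ys))))
  where
  stillIn : ∀ {z} → x ≢ z → z ∈ ys → z ∈ remove ys x∈ys
  stillIn x≢z z∈ys = ∈-remove ys x∈ys z∈ys (≢-sym x≢z)

unique-covers : DecidableEquality A → {xs W : List A} →
  Unique xs → All (_∈ W) xs → length W ≤ length xs → ∀ {w} → w ∈ W → w ∈ xs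
unique-covers _≟_ {xs} u xs⊆W W≤xs {w} w∈W with w ∈? xs
  where open DecMembership _≟_ using (_∈?_)
... | yes w∈xs = w∈xs
... | no  w∉xs =
  ⊥-elim (1+n≰n (≤-trans (unique-length≤ (¬Any⇒All¬ xs w∉xs ∷ u) (w∈W ∷ xs⊆W)) W≤xs))

unique-rotate : (xs : List A) {ys : List A} → Unique (xs ++ ys) → Unique (ys ++ xs)
unique-rotate xs {ys} u with split xs u
  where
  split : ∀ xs → Unique (xs ++ ys) → Unique xs × Unique ys × All (λ x → All (x ≢_) ys) xs
  split []       u         = [] , u , []
  split (x ∷ xs) (x∉ ∷ u) with split xs u | All-++⁻ xs x∉
  ... | uxs , uys , apart | x∉xs , x∉ys = (x∉xs ∷ uxs) , uys , (x∉ys ∷ apart)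
... | uxs , uys , apart =
  AllPairsₚ.++⁺ uys uxs (All.map (All.map ≢-sym) (All-swap apart))

dropLast-++ : (xs : List A) (y : A) (ys : List A) → dropLast (xs ++ y ∷ ys) ≡ xs ++ dropLast (y ∷ ys)
dropLast-++ []           y ys = refl
dropLast-++ (x ∷ [])     y ys = refl
dropLast-++ (x ∷ x′ ∷ xs) y ys = cong (x ∷_) (dropLast-++ (x′ ∷ xs) y ys)

dropLast-snoc : (xs : List A) (y : A) → dropLast (xs ++ [ y ]) ≡ xs
dropLast-snoc xs y = trans (dropLast-++ xs y []) (++-identityʳ xs)

dropLast-take : (m : ℕ) (xs : List A) → suc m ≤ length xs → dropLast (take (suc m) xs) ≡ take m xs
dropLast-take zero    (x ∷ xs)     _         = refl
dropLast-take (suc m) (x ∷ y ∷ xs) (s≤s m<) = cong (x ∷_) (dropLast-take m (y ∷ xs) m<)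

∈-take : {z : A} (m : ℕ) (xs : List A) → z ∈ take m xs → z ∈ xs
∈-take (suc m) (x ∷ xs) (here e)  = here e
∈-take (suc m) (x ∷ xs) (there p) = there (∈-take m xs p)

∈-take-mono : {z : A} {m m′ : ℕ} (xs : List A) → m ≤ m′ → z ∈ take m xs → z ∈ take m′ xs
∈-take-mono (x ∷ xs) (s≤s m≤) (here e)  = here e
∈-take-mono (x ∷ xs) (s≤s m≤) (there p) = there (∈-take-mono xs m≤ p)

∈-take-++ˡ : {z : A} (m : ℕ) (xs ys : List A) → m ≤ length xs → z ∈ take m (xs ++ ys) → z ∈ xs
∈-take-++ˡ (suc m) (x ∷ xs) ys _        (here e)  = here e
∈-take-++ˡ (suc m) (x ∷ xs) ys (s≤s m≤) (there p) = there (∈-take-++ˡ m xs ys m≤ p)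

∈-take-++ : {z : A} (m : ℕ) (xs ys : List A) → z ∈ take m (xs ++ ys) → z ∈ xs ⊎ z ∈ take m ys
∈-take-++ (suc m) []       ys p         = inj₂ p
∈-take-++ (suc m) (x ∷ xs) ys (here e)  = inj₁ (here e)
∈-take-++ (suc m) (x ∷ xs) ys (there p) with ∈-take-++ m xs ys p
... | inj₁ q = inj₁ (there q)
... | inj₂ q = inj₂ (∈-take-mono ys (n≤1+n m) q)

linked-take : {R : A → A → Set} (m : ℕ) {xs : List A} → Linked R xs → Linked R (take m xs)
linked-take zero          _       = []
linked-take (suc m)       []      = []
linked-take (suc zero)    [-]     = [-]
linked-take (suc (suc m)) [-]     = [-]
linked-take (suc zero)    (r ∷ l) = [-]
linked-take (suc (suc m)) (r ∷ l) = r ∷ linked-take (suc m) l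

linked-join : {R : A → A → Set} (xs : List A) {y : A} {ys : List A} →
  Linked R (xs ++ [ y ]) → Linked R (y ∷ ys) → Linked R (xs ++ y ∷ ys)
linked-join []            _       l = l
linked-join (x ∷ [])      (r ∷ _) l = r ∷ l
linked-join (x ∷ x′ ∷ xs) (r ∷ l′) l = r ∷ linked-join (x′ ∷ xs) l′ l

linked-split : {R : A → A → Set} (xs : List A) {y : A} {ys : List A} →
  Linked R (xs ++ y ∷ ys) → Linked R (xs ++ [ y ]) × Linked R (y ∷ ys)
linked-split []            l       = [-] , l
linked-split (x ∷ [])      (r ∷ l) = (r ∷ [-]) , l
linked-split (x ∷ x′ ∷ xs) (r ∷ l) with linked-split (x′ ∷ xs) l
... | l₁ , l₂ = (r ∷ l₁) , l₂

linked-tail : {R : A → A → Set} {x : A} {xs : List A} → Linked R (x ∷ xs) → Linked R xs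
linked-tail [-]     = []
linked-tail (_ ∷ l) = l

linked-map : {R S : A → A → Set} {P : A → Set} {xs : List A} →
  (∀ {x y} → P x → P y → R x y → S x y) → All P xs → Linked R xs → Linked S xs
linked-map f []             []      = []
linked-map f (_ ∷ [])       [-]     = [-]
linked-map f (p ∷ q ∷ ps)   (r ∷ l) = f p q r ∷ linked-map f (q ∷ ps) l

rotate-closed : {R : A → A → Set} (a : A) (P : List A) {v : A} (Q : List A) →
  Linked R (a ∷ P ++ v ∷ Q ++ [ a ]) → Linked R (v ∷ Q ++ a ∷ P ++ [ v ])
rotate-closed a P Q l with linked-split (a ∷ P) l
... | a…v , v…a = linked-join (_ ∷ Q) v…a a…v

-- Walks are listed from the last position backwards, so the current snake is always a
-- prefix of the remaining list.
module Sliding {A : Set} (Vx : A → Set) (E : A → A → Set) (K : ℕ) where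

  Spread : List A → Set
  Spread []       = ⊤
  Spread (z ∷ zs) = z ∉ take K zs × Spread zs

  SlideWalk : List A → Set
  SlideWalk Z = All Vx Z × Linked E Z × Spread Z

  unique⇒spread : {xs : List A} → Unique xs → Spread xs
  unique⇒spread []                  = tt
  unique⇒spread {x ∷ xs} (x∉xs ∷ u) = (λ p → All¬⇒¬Any x∉xs (∈-take K xs p)) , unique⇒spread u

  spread-++ : (xs : List A) {ys : List A} → Unique xs → All (λ x → x ∉ take K ys) xs →
    Spread ys → Spread (xs ++ ys)
  spread-++ []       _          _            s = s
  spread-++ (x ∷ xs) {ys} (x∉xs ∷ u) (x∉ys ∷ apart) s = x∉ , spread-++ xs u apart s
    where
    x∉ : x ∉ take K (xs ++ ys)
    x∉ p with ∈-take-++ K xs ys p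
    ... | inj₁ q = All¬⇒¬Any x∉xs q
    ... | inj₂ q = x∉ys q

  spread-window : (m : ℕ) (xs : List A) → m ≤ suc K → Spread xs → Unique (take m xs)
  spread-window zero    xs       _        _          = []
  spread-window (suc m) []       _        _          = []
  spread-window (suc m) (x ∷ xs) (s≤s m≤) (x∉ , s) =
    ¬Any⇒All¬ (take m xs) (λ p → x∉ (∈-take-mono xs m≤ p)) ∷ spread-window m xs (≤-trans m≤ (n≤1+n K)) s

  window-config : (xs : List A) → suc K ≤ length xs → SlideWalk xs → IsConfig Vx E (suc K) (take (suc K) xs)
  window-config xs len (inV , l , s) =
    length-take′ , All.tabulate (λ p → All.lookup inV (∈-take (suc K) xs p)) ,
    spread-window (suc K) xs ≤-refl s , linked-take (suc K) l
    where
    length-take′ : length (take (suc K) xs) ≡ suc K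
    length-take′ = trans (length-take (suc K) xs) (m≤n⇒m⊓n≡m len)

  slide-step : (h : A) (xs : List A) → suc K ≤ length xs → SlideWalk (h ∷ xs) →
    OneTransition Vx E (suc K) (take (suc K) xs) (take (suc K) (h ∷ xs))
  slide-step h xs len w@(_ ∷ inV , l , _ , s) =
    window-config xs len (inV , linked-tail l , s) , window-config (h ∷ xs) (≤-trans len (n≤1+n _)) w , h ,
    cong (h ∷_) (sym (dropLast-take K xs len)) ,
    (λ p → h∉ (subst (h ∈_) (dropLast-take K xs len) p))
    where
    h∉ : h ∉ take K xs
    h∉ = proj₁ (proj₂ (proj₂ w))

  slide : (pre xs : List A) → pre ≢ [] → suc K ≤ length xs → SlideWalk (pre ++ xs) →
    YesInstance Vx E (suc K) (take (suc K) xs) (take (suc K) (pre ++ xs))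
  slide []            xs pre≢[] _   _ = ⊥-elim (pre≢[] refl)
  slide (y ∷ [])      xs _      len w = [ slide-step y xs len w ]⁺
  slide (y ∷ y′ ∷ ys) xs _      len w@(_ ∷ inV , l , _ , s) =
    slide (y′ ∷ ys) xs (λ ()) len (inV , linked-tail l , s) ∷ʳ
    slide-step y (y′ ∷ ys ++ xs) (≤-trans len (length-++-≤ʳ xs {y′ ∷ ys})) w

-- Unit moves of the grid (the first coordinate is the row, the second the column).
data Step : Pt → Pt → Set where
  east  : ∀ {a b} → Step (a , b) (a , suc b)
  west  : ∀ {a b} → Step (a , suc b) (a , b)
  south : ∀ {a b} → Step (a , b) (suc a , b)
  north : ∀ {a b} → Step (suc a , b) (a , b)

∣n-1+n∣≡1 : ∀ b → ∣ b - suc b ∣ ≡ 1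
∣n-1+n∣≡1 zero    = refl
∣n-1+n∣≡1 (suc b) = ∣n-1+n∣≡1 b

∣a-b∣≡1 : ∀ a b → ∣ a - b ∣ ≡ 1 → b ≡ suc a ⊎ a ≡ suc b
∣a-b∣≡1 zero    b       e = inj₁ e
∣a-b∣≡1 (suc a) zero    e = inj₂ (cong suc (suc-injective e))
∣a-b∣≡1 (suc a) (suc b) e with ∣a-b∣≡1 a b e
... | inj₁ e′ = inj₁ (cong suc e′)
... | inj₂ e′ = inj₂ (cong suc e′)

step⇒adj : ∀ {p q} → Step p q → Adj p q
step⇒adj (east {a} {b})  = cong₂ _+_ (∣n-n∣≡0 a) (∣n-1+n∣≡1 b)
step⇒adj (west {a} {b})  = cong₂ _+_ (∣n-n∣≡0 a) (trans (∣-∣-comm (suc b) b) (∣n-1+n∣≡1 b))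
step⇒adj (south {a} {b}) = cong₂ _+_ (∣n-1+n∣≡1 a) (∣n-n∣≡0 b)
step⇒adj (north {a} {b}) = cong₂ _+_ (trans (∣-∣-comm (suc a) a) (∣n-1+n∣≡1 a)) (∣n-n∣≡0 b)

adj⇒step : ∀ p q → Adj p q → Step p q
adj⇒step (a , b) (a′ , b′) e with ∣ a - a′ ∣ in rows
... | zero with ∣m-n∣≡0⇒m≡n {a} {a′} rows | ∣a-b∣≡1 b b′ e
...   | refl | inj₁ refl = east
...   | refl | inj₂ refl = west
adj⇒step (a , b) (a′ , b′) e | suc zero with ∣m-n∣≡0⇒m≡n {b} {b′} (suc-injective e) | ∣a-b∣≡1 a a′ rows
...   | refl | inj₁ refl = south
...   | refl | inj₂ refl = north

step-irrefl : ∀ {p} → ¬ Step p p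
step-irrefl {a , b} st with trans (sym (cong₂ _+_ (∣n-n∣≡0 a) (∣n-n∣≡0 b))) (step⇒adj st)
... | ()

step-sym : ∀ {p q} → Step p q → Step q p
step-sym east  = west
step-sym west  = east
step-sym south = north
step-sym north = south

step-col≤ : ∀ {p q} → Step p q → proj₂ q ≤ suc (proj₂ p)
step-col≤ east  = ≤-refl
step-col≤ west  = ≤-trans (n≤1+n _) (n≤1+n _)
step-col≤ south = n≤1+n _
step-col≤ north = n≤1+n _

step-row≤ : ∀ {p q} → Step p q → proj₁ q ≤ suc (proj₁ p)
step-row≤ east  = n≤1+n _
step-row≤ west  = n≤1+n _
step-row≤ south = ≤-refl
step-row≤ north = ≤-trans (n≤1+n _) (n≤1+n _)

minL≤ : ∀ {x} xs → x ∈ xs → minL xs ≤ x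
minL≤ (x ∷ [])     (here refl) = ≤-refl
minL≤ (x ∷ y ∷ xs) (here refl) = m⊓n≤m x _
minL≤ (x ∷ y ∷ xs) (there p)   = ≤-trans (m⊓n≤n x _) (minL≤ (y ∷ xs) p)

minL∈ : ∀ {x} xs → x ∈ xs → minL xs ∈ xs
minL∈ (x ∷ xs) _ = minL∷∈ x xs
  where
  minL∷∈ : ∀ x xs → minL (x ∷ xs) ∈ x ∷ xs
  minL∷∈ x []       = here refl
  minL∷∈ x (y ∷ xs) with ⊓-sel x (minL (y ∷ xs))
  ... | inj₁ e = here e
  ... | inj₂ e = subst (_∈ x ∷ y ∷ xs) (sym e) (there (minL∷∈ y xs))

module ColumnSpan (V : List Pt) (connected : Connected V) where

  col : Pt → ℕ
  col = proj₂

  -- along a walk the column changes by at most one per step, so it takes every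
  -- intermediate value
  walk-hits : ∀ {u v} → Star (GridEdge V) u v → u ∈ V → ∀ k → col u ≤ k → k ≤ col v →
    ∃[ w ] (w ∈ V × col w ≡ k)
  walk-hits {u} ε u∈V k u≤k k≤v = u , u∈V , ≤-antisym u≤k k≤v
  walk-hits {u} (_◅_ {j = u′} (_ , u′∈V , a) walk) u∈V k u≤k k≤v with k ≤? col u
  ... | yes k≤u = u , u∈V , ≤-antisym u≤k k≤u
  ... | no  k≰u = walk-hits walk u′∈V k (≤-trans (step-col≤ (adj⇒step u u′ a)) (≰⇒> k≰u)) k≤v

  module _ {q p : Pt} (q∈V : q ∈ V) (p∈V : p ∈ V) where

    column-witnesses : ∀ d → col q + d ≤ col p →
      ∃[ L ] (length L ≡ suc d × Unique L × All (_∈ V) L × All (λ w → col w ≤ col q + d) L)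
    column-witnesses zero _ =
      [ q ] , refl , ([] ∷ []) , (q∈V ∷ []) , (≤-reflexive (sym (+-identityʳ (col q))) ∷ [])
    column-witnesses (suc d) q+d<p
      with column-witnesses d (≤-trans (+-monoʳ-≤ (col q) (n≤1+n d)) q+d<p)
         | walk-hits (connected q p q∈V p∈V) q∈V (col q + suc d) (m≤m+n (col q) (suc d)) q+d<p
    ... | L , len , u , L⊆V , L≤ | w , w∈V , w≡ =
      (w ∷ L) , cong suc len , (All.map w≢ L≤ ∷ u) , (w∈V ∷ L⊆V) ,
      (≤-reflexive w≡ ∷ All.map (λ le → ≤-trans le (+-monoʳ-≤ (col q) (n≤1+n d))) L≤)
      where
      w≢ : ∀ {z} → col z ≤ col q + d → w ≢ z
      w≢ z≤ refl = 1+n≰n (subst (_≤ col q + d) (trans w≡ (+-suc (col q) d)) z≤)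

  column-span : ∀ {p} → p ∈ V → suc (col p ∸ cHat V) ≤ length V
  column-span {p} p∈V with ∈-map⁻ col (minL∈ (map col V) (∈-map⁺ col p∈V))
  ... | q , q∈V , ĉ≡ with column-witnesses q∈V p∈V (col p ∸ col q)
                            (≤-reflexive (m+[n∸m]≡n (subst (_≤ col p) ĉ≡ (minL≤ (map col V) (∈-map⁺ col p∈V)))))
  ... | L , len , u , L⊆V , _ =
    subst (λ c → suc (col p ∸ c) ≤ length V) (sym ĉ≡) (subst (_≤ length V) len (unique-length≤ u L⊆V))

ham-transfer : (V W : List Pt) (f g : Pt → Pt) →
  (∀ {w} → w ∈ W → f w ∈ V) → (∀ {p} → p ∈ V → g p ∈ W) →
  (∀ {p} → p ∈ V → f (g p) ≡ p) → (∀ {w} → w ∈ W → g (f w) ≡ w) →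
  (∀ {w w′} → w ∈ W → w′ ∈ W → Adj w w′ → Adj (f w) (f w′)) →
  HasHamCycle W → HasHamCycle V
ham-transfer V W f g f∈ g∈ fg gf f-adj (x , xs , three≤ , u , inW , covers , cycle) =
  f x , map f xs ,
  subst (3 ≤_) (cong suc (sym (length-map f xs))) three≤ ,
  Unique.map⁻ (subst Unique (sym gf-cycle) u) ,
  All-map⁺ (All.map f∈ inW) ,
  (λ p p∈V → subst (_∈ map f (x ∷ xs)) (fg p∈V) (∈-map⁺ f (covers (g p) (g∈ p∈V)))) ,
  subst (Linked (GridEdge V)) (map-++ f (x ∷ xs) [ x ]) (Linked-map⁺ (Linked.map edge cycle))
  where
  gf-cycle : map g (map f (x ∷ xs)) ≡ x ∷ xs
  gf-cycle = trans (sym (map-∘ (x ∷ xs))) (map-id-local (All.map gf inW))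
  edge : ∀ {w w′} → GridEdge W w w′ → GridEdge V (f w) (f w′)
  edge (w∈W , w′∈W , a) = f∈ w∈W , f∈ w′∈W , f-adj w∈W w′∈W a

ℓ₁ : Pt → Pt → ℕ
ℓ₁ p q = ∣ proj₁ p - proj₁ q ∣ + ∣ proj₂ p - proj₂ q ∣

∣-∣-shift : ∀ {r a a′} N → r ≤ a → r ≤ a′ → ∣ a ∸ r + N - a′ ∸ r + N ∣ ≡ ∣ a - a′ ∣
∣-∣-shift {r} {a} {a′} N r≤a r≤a′ = begin
  ∣ a ∸ r + N - a′ ∸ r + N ∣     ≡⟨ cong₂ ∣_-_∣ (+-comm (a ∸ r) N) (+-comm (a′ ∸ r) N) ⟩
  ∣ N + (a ∸ r) - N + (a′ ∸ r) ∣ ≡⟨ ∣m+n-m+o∣≡∣n-o∣ N (a ∸ r) (a′ ∸ r) ⟩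
  ∣ a ∸ r - a′ ∸ r ∣             ≡⟨ ∣m+n-m+o∣≡∣n-o∣ r (a ∸ r) (a′ ∸ r) ⟨
  ∣ r + (a ∸ r) - r + (a′ ∸ r) ∣ ≡⟨ cong₂ ∣_-_∣ (m+[n∸m]≡n r≤a) (m+[n∸m]≡n r≤a′) ⟩
  ∣ a - a′ ∣                     ∎
  where open ≡-Reasoning

module Translation (n i : ℕ) (V : List Pt) where

  shift unshift : Pt → Pt
  shift   (a , b) = (a ∸ rHat V + suc n , b ∸ cHat V + i * suc n)
  unshift (a , b) = (a ∸ suc n + rHat V , b ∸ i * suc n + cHat V)

  -- r̂ and ĉ bound the coordinates of V from below, so shift is invertible on V
  r̂≤ : ∀ {p} → p ∈ V → rHat V ≤ proj₁ p
  r̂≤ p∈V = minL≤ (map proj₁ V) (∈-map⁺ proj₁ p∈V)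

  ĉ≤ : ∀ {p} → p ∈ V → cHat V ≤ proj₂ p
  ĉ≤ p∈V = minL≤ (map proj₂ V) (∈-map⁺ proj₂ p∈V)

  unshift-shift : ∀ {p} → p ∈ V → unshift (shift p) ≡ p
  unshift-shift {a , b} p∈V = cong₂ _,_
    (trans (cong (_+ rHat V) (m+n∸n≡m (a ∸ rHat V) (suc n))) (m∸n+n≡m (r̂≤ p∈V)))
    (trans (cong (_+ cHat V) (m+n∸n≡m (b ∸ cHat V) (i * suc n))) (m∸n+n≡m (ĉ≤ p∈V)))

  shift-isometry : ∀ {p q} → p ∈ V → q ∈ V → ℓ₁ (shift p) (shift q) ≡ ℓ₁ p q
  shift-isometry p∈V q∈V =
    cong₂ _+_ (∣-∣-shift (suc n) (r̂≤ p∈V) (r̂≤ q∈V)) (∣-∣-shift (i * suc n) (ĉ≤ p∈V) (ĉ≤ q∈V))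

  shift-adj : ∀ {p q} → p ∈ V → q ∈ V → Adj p q → Adj (shift p) (shift q)
  shift-adj p∈V q∈V a = trans (shift-isometry p∈V q∈V) a

  W : List Pt
  W = translate n i V

  ∈W⁻ : ∀ {w} → w ∈ W → unshift w ∈ V × shift (unshift w) ≡ w
  ∈W⁻ w∈W with ∈-map⁻ shift w∈W
  ... | p , p∈V , refl = subst (_∈ V) (sym (unshift-shift p∈V)) p∈V , cong shift (unshift-shift p∈V)

  unshift-adj : ∀ {w w′} → w ∈ W → w′ ∈ W → Adj w w′ → Adj (unshift w) (unshift w′)
  unshift-adj w∈W w′∈W a with ∈-map⁻ shift w∈W | ∈-map⁻ shift w′∈W
  ... | p , p∈V , refl | q , q∈V , refl =
    subst₂ Adj (sym (unshift-shift p∈V)) (sym (unshift-shift q∈V)) (trans (sym (shift-isometry p∈V q∈V)) a)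

  unique-translate : Unique V → Unique W
  unique-translate u = Unique.map⁻ (subst Unique (sym back) u)
    where
    back : map unshift W ≡ V
    back = trans (sym (map-∘ V)) (map-id-local (All.tabulate unshift-shift))

  ham-translate : HasHamCycle V → HasHamCycle W
  ham-translate = ham-transfer W V shift unshift (∈-map⁺ shift) (proj₁ ∘ ∈W⁻) (proj₂ ∘ ∈W⁻)
    unshift-shift shift-adj

  ham-untranslate : HasHamCycle W → HasHamCycle V
  ham-untranslate = ham-transfer V W unshift shift (proj₁ ∘ ∈W⁻) (∈-map⁺ shift) unshift-shift
    (proj₂ ∘ ∈W⁻) unshift-adj

Near : ℕ → ℕ → Set
Near a b = a ≤ suc b × b ≤ suc a

step-near-col : ∀ {p q} → Step p q → Near (proj₂ p) (proj₂ q)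
step-near-col st = step-col≤ (step-sym st) , step-col≤ st

step-near-row : ∀ {p q} → Step p q → Near (proj₁ p) (proj₁ q)
step-near-row st = step-row≤ (step-sym st) , step-row≤ st

far : ∀ {a b} → suc (suc a) ≤ b → ¬ Near a b
far a+2≤b (_ , b≤a+1) = 1+n≰n (≤-trans a+2≤b b≤a+1)

-- The instance HamToSna(G₁,…,G_t) for n = k + 3 and t = s + 1.  The snake lives on
-- the track (row n-1), which is joined at the gates (n, c_i) to the entries
-- (n+1, c_i) of the translated copies G'_i, and at column n-2 to the final position.
module Construction (k s : ℕ) (Gs : Fin (suc s) → List Pt)
  (hyp : ∀ i → Unique (Gs i) × length (Gs i) ≡ suc (suc (suc k)) × Connected (Gs i))
  (c : Fin (suc s) → ℕ)
  (entry∈ : ∀ i → (suc (suc (suc (suc k))) , c i) ∈ HamToSna.G' (suc (suc (suc k))) (suc s) Gs c i) where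

  n track exit : ℕ
  n     = suc (suc (suc k))
  track = suc (suc k)
  exit  = suc k

  open HamToSna n (suc s) Gs c

  gate entry : Fin (suc s) → Pt
  gate  i = (n , c i)
  entry i = (suc n , c i)

  offset : Fin (suc s) → ℕ
  offset j = suc (toℕ j) * suc n

  module T (j : Fin (suc s)) = Translation n (suc (toℕ j)) (Gs j)

  G'-row : ∀ {j p} → p ∈ G' j → suc n ≤ proj₁ p
  G'-row {j} p∈G with ∈-map⁻ (T.shift j) p∈G
  ... | q , _ , refl = m≤n+m (suc n) _

  G'-col≥ : ∀ {j p} → p ∈ G' j → offset j ≤ proj₂ p
  G'-col≥ {j} p∈G with ∈-map⁻ (T.shift j) p∈G
  ... | q , _ , refl = m≤n+m (offset j) _

  G'-col≤ : ∀ {j p} → p ∈ G' j → proj₂ p ≤ track + offset j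
  G'-col≤ {j} p∈G with ∈-map⁻ (T.shift j) p∈G
  ... | q , q∈G , refl = +-monoˡ-≤ (offset j) (≤-pred (subst (suc (proj₂ q ∸ cHat (Gs j)) ≤_) length≡n span))
    where
    length≡n = proj₁ (proj₂ (hyp j))
    span = ColumnSpan.column-span (Gs j) (proj₂ (proj₂ (hyp j))) q∈G

  G'-apart : ∀ {i j p q} → p ∈ G' i → q ∈ G' j → toℕ i < toℕ j → suc (suc (proj₂ p)) ≤ proj₂ q
  G'-apart p∈G q∈G i<j =
    ≤-trans (s≤s (s≤s (G'-col≤ p∈G))) (≤-trans (*-monoˡ-≤ (suc n) (s≤s i<j)) (G'-col≥ q∈G))

  G'-same : ∀ {i j p q} → p ∈ G' i → q ∈ G' j → Near (proj₂ p) (proj₂ q) → i ≡ j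
  G'-same {i} {j} p∈G q∈G near with <-cmp (toℕ i) (toℕ j)
  ... | tri< i<j _ _ = ⊥-elim (far (G'-apart p∈G q∈G i<j) near)
  ... | tri≈ _ i≡j _ = toℕ-injective i≡j
  ... | tri> _ _ j<i = ⊥-elim (far (G'-apart q∈G p∈G j<i) (swap near))

  entry-owner : ∀ {i j} → entry j ∈ G' i → i ≡ j
  entry-owner {i} {j} e∈G = G'-same e∈G (entry∈ j) (n≤1+n _ , n≤1+n _)

  c≥ : ∀ i → suc n ≤ c i
  c≥ i = ≤-trans (m≤m+n (suc n) _) (G'-col≥ (entry∈ i))

  c≤cLast : ∀ i → c i ≤ cLast
  c≤cLast i with m≤n⇒m<n∨m≡n (toℕ≤pred[n] i)
  ... | inj₁ i<s = ≤-trans (n≤1+n _) (≤-trans (n≤1+n _)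
        (G'-apart (entry∈ i) (entry∈ (fromℕ s)) (subst (toℕ i <_) (sym (toℕ-fromℕ s)) i<s)))
  ... | inj₂ i≡s = ≤-reflexive (cong c (toℕ-injective (trans i≡s (sym (toℕ-fromℕ s)))))

  track∈ : ∀ i {y} → y ≤ c i → VG (track , y)
  track∈ i {y} y≤c with y ≤? track
  ... | yes y≤track = inj₁ (inj₁ (refl , s≤s y≤track))
  ... | no  y≰track = inj₂ (inj₁ (inj₁ (refl , ≰⇒> y≰track , ≤-trans y≤c (c≤cLast i))))

  exit∈ : ∀ {x} → x < n → VG (x , exit)
  exit∈ x<n = inj₁ (inj₂ (x<n , refl))

  gate∈ : ∀ i → VG (gate i)
  gate∈ i = inj₂ (inj₁ (inj₂ (i , refl)))

  G'∈ : ∀ {i p} → p ∈ G' i → VG p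
  G'∈ {i} p∈G = inj₂ (inj₂ (i , p∈G))

  row-n : ∀ {b} → VG (n , b) → ∃[ j ] (b ≡ c j)
  row-n (inj₁ (inj₁ (n≡track , _)))       = ⊥-elim (1+n≰n (≤-reflexive n≡track))
  row-n (inj₁ (inj₂ (n<n , _)))           = ⊥-elim (<-irrefl refl n<n)
  row-n (inj₂ (inj₁ (inj₁ (n≡track , _)))) = ⊥-elim (1+n≰n (≤-reflexive n≡track))
  row-n (inj₂ (inj₁ (inj₂ (j , refl))))    = j , refl
  row-n (inj₂ (inj₂ (j , p∈G)))            = ⊥-elim (1+n≰n (G'-row p∈G))

  not-above-track : ∀ {y} → track ≤ y → ¬ VG (exit , y)
  not-above-track _       (inj₁ (inj₁ (e , _)))         = 1+n≰n (≤-reflexive (sym e))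
  not-above-track track≤y (inj₁ (inj₂ (_ , refl)))      = 1+n≰n track≤y
  not-above-track _       (inj₂ (inj₁ (inj₁ (e , _))))  = 1+n≰n (≤-reflexive (sym e))
  not-above-track _       (inj₂ (inj₁ (inj₂ (_ , e))))  =
    1+n≰n (≤-trans (n≤1+n _) (≤-reflexive (sym (cong proj₁ e))))
  not-above-track _       (inj₂ (inj₂ (_ , p∈G)))       = 1+n≰n (≤-trans (m≤n+m track 2) (G'-row p∈G))

  gates-apart : ∀ i j → ¬ Step (gate i) (gate j)
  gates-apart i j st with G'-same (entry∈ i) (entry∈ j) (step-near-col st)
  ... | refl = step-irrefl st

  below-neighbour : ∀ {p h} → suc n ≤ proj₁ p → VG h → Step p h → (∃[ j ] (h ≡ gate j)) ⊎ V3 h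
  below-neighbour p>n (inj₁ (inj₁ (refl , _)))       st = ⊥-elim (far p>n (swap (step-near-row st)))
  below-neighbour p>n (inj₁ (inj₂ (a<n , _)))        st =
    ⊥-elim (far (≤-trans (s≤s a<n) p>n) (swap (step-near-row st)))
  below-neighbour p>n (inj₂ (inj₁ (inj₁ (refl , _)))) st = ⊥-elim (far p>n (swap (step-near-row st)))
  below-neighbour p>n (inj₂ (inj₁ (inj₂ (j , e))))    st = inj₁ (j , e)
  below-neighbour p>n (inj₂ (inj₂ h∈G))               st = inj₂ h∈G

  gate-neighbour : ∀ {p b} → suc n ≤ proj₁ p → Step p (n , b) → p ≡ (suc n , b)
  gate-neighbour n<n west  = ⊥-elim (<-irrefl refl n<n)
  gate-neighbour n<n east  = ⊥-elim (<-irrefl refl n<n)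
  gate-neighbour n<n south = ⊥-elim (1+n≰n (≤-trans n<n (n≤1+n _)))
  gate-neighbour _   north = refl

  seg : ℕ → ℕ → List Pt
  seg y zero    = []
  seg y (suc m) = (track , y) ∷ seg (y ∸ 1) m

  dropLast-seg : ∀ y m → dropLast (seg y (suc m)) ≡ seg y m
  dropLast-seg y zero    = refl
  dropLast-seg y (suc m) = cong ((track , y) ∷_) (dropLast-seg (y ∸ 1) m)

  init≡seg : init ≡ seg track n
  init≡seg = descending track
    where
    descending : ∀ m → map (λ j → (track , j)) (downFrom (suc m)) ≡ seg m (suc m)
    descending zero    = refl
    descending (suc m) = cong ((track , suc m) ∷_) (descending m)

  length-G' : ∀ i → length (G' i) ≡ n
  length-G' i = trans (length-map (T.shift i) (Gs i)) (proj₁ (proj₂ (hyp i)))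

  HamSomewhere : Set
  HamSomewhere = ∃[ i ] HasHamCycle (Gs i)

  -- The configurations reachable from init (as long as no Hamiltonian cycle has been
  -- traversed): the snake runs rightwards on the track, turns into a gate, and then
  -- its head part stays inside the copy G'_i behind entry i.
  data Phase : List Pt → Set where
    on-track : ∀ {y} → track ≤ y → Phase (seg y n)
    at-gate  : ∀ i → Phase (gate i ∷ seg (c i) track)
    entering : ∀ i D m → All (_∈ G' i) D → Phase (D ++ entry i ∷ gate i ∷ seg (c i) m)
    inside   : ∀ i D → All (_∈ G' i) D → Phase (D ++ [ entry i ])

  -- In every phase the head is at or below the track, so fin (head at row 0) is never reached.
  head-row : List Pt → ℕ
  head-row []      = 0
  head-row (p ∷ _) = proj₁ p

  phase-head : ∀ {cf} → Phase cf → track ≤ head-row cf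
  phase-head (on-track _)               = ≤-refl
  phase-head (at-gate i)                = n≤1+n track
  phase-head (entering i []      m _)   = ≤-trans (n≤1+n _) (n≤1+n _)
  phase-head (entering i (d ∷ D) m (d∈G ∷ _)) = ≤-trans (≤-trans (n≤1+n _) (n≤1+n _)) (G'-row d∈G)
  phase-head (inside i []      _)       = ≤-trans (n≤1+n _) (n≤1+n _)
  phase-head (inside i (d ∷ D) (d∈G ∷ _)) = ≤-trans (≤-trans (n≤1+n _) (n≤1+n _)) (G'-row d∈G)

  fin-unreachable : ¬ Phase fin
  fin-unreachable ph with phase-head ph
  ... | ()

  head-step : ∀ {h x} xs → xs ≢ [] → Linked EG (h ∷ dropLast (x ∷ xs)) → VG h × Step x h
  head-step []      xs≢[] _                  = ⊥-elim (xs≢[] refl)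
  head-step (_ ∷ _) _     ((vh , _ , a) ∷ _) = vh , step-sym (adj⇒step _ _ a)

  ++-∷≢[] : ∀ (xs : List Pt) {y ys} → xs ++ y ∷ ys ≢ []
  ++-∷≢[] []      ()
  ++-∷≢[] (_ ∷ _) ()

  from-track : ∀ {y h} → track ≤ y → VG h → Step (track , y) h → h ∉ dropLast (seg y n) →
    Phase (h ∷ dropLast (seg y n))
  from-track {y} t≤y _ east _ =
    subst Phase (cong ((track , suc y) ∷_) (sym (dropLast-seg y track))) (on-track (≤-trans t≤y (n≤1+n y)))
  from-track _ _ west h∉ = ⊥-elim (h∉ (there (here refl)))
  from-track {y} _ vh south _ with row-n vh
  ... | j , refl = subst Phase (cong (gate j ∷_) (sym (dropLast-seg (c j) track))) (at-gate j)
  from-track t≤y vh north _ = ⊥-elim (not-above-track t≤y vh)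

  -- A horizontal move from a gate stays in row n, whose vertices are gates.
  gate-row-move : ∀ i {b b′} → b ≡ c i → VG (n , b′) → ¬ Step (n , b) (n , b′)
  gate-row-move i refl vh st with row-n vh
  ... | j , refl = gates-apart i j st

  from-gate : ∀ i {b h} → b ≡ c i → VG h → Step (n , b) h → h ∉ dropLast (gate i ∷ seg (c i) track) →
    Phase (h ∷ dropLast (gate i ∷ seg (c i) track))
  from-gate i b≡ vh east  _  = ⊥-elim (gate-row-move i b≡ vh east)
  from-gate i b≡ vh west  _  = ⊥-elim (gate-row-move i b≡ vh west)
  from-gate i refl _ south _ =
    subst Phase (cong (λ z → entry i ∷ gate i ∷ z) (sym (dropLast-seg (c i) exit))) (entering i [] exit [])
  from-gate i refl _ north h∉ = ⊥-elim (h∉ (there (here refl)))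

  copy-neighbour : ∀ {i x h} → x ∈ G' i → VG h → Step x h → h ∈ G' i ⊎ (x ≡ entry i × h ≡ gate i)
  copy-neighbour {i} x∈G vh st with below-neighbour (G'-row x∈G) vh st
  ... | inj₁ (j , refl) with gate-neighbour (G'-row x∈G) st
  ...   | refl with entry-owner x∈G
  ...     | refl = inj₂ (refl , refl)
  copy-neighbour {i} x∈G vh st | inj₂ (j , h∈G) with G'-same x∈G h∈G (step-near-col st)
  ... | refl = inj₁ h∈G

  body-head : Fin (suc s) → List Pt → Pt
  body-head i []      = entry i
  body-head i (d ∷ _) = d

  body-head∈ : ∀ i {D} → All (_∈ G' i) D → body-head i D ∈ G' i
  body-head∈ i []          = entry∈ i
  body-head∈ i (d∈G ∷ _) = d∈G

  from-entering : ∀ i D m {h} → All (_∈ G' i) D → let cf = D ++ entry i ∷ gate i ∷ seg (c i) m in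
    length cf ≡ n → Unique cf → VG h → Step (body-head i D) h → h ∉ dropLast cf → Phase (h ∷ dropLast cf)
  from-entering i D m D⊆G len u vh st h∉
    with copy-neighbour (body-head∈ i D⊆G) vh st
  from-entering i D zero    D⊆G len u vh st h∉ | inj₁ h∈G =
    subst Phase (cong (_ ∷_) (sym (dropLast-++ D (entry i) [ gate i ]))) (inside i (_ ∷ D) (h∈G ∷ D⊆G))
  from-entering i D (suc m) D⊆G len u vh st h∉ | inj₁ h∈G =
    subst Phase (cong (_ ∷_) (sym (trans (dropLast-++ D (entry i) (gate i ∷ seg (c i) (suc m)))
                                   (cong (λ z → D ++ entry i ∷ gate i ∷ z) (dropLast-seg (c i) m)))))
      (entering i (_ ∷ D) m (h∈G ∷ D⊆G))
  from-entering i []      zero    _ () _ _ _ _ | inj₂ _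
  from-entering i []      (suc m) _ _  _ _ _ h∉ | inj₂ (_ , refl) = ⊥-elim (h∉ (there (here refl)))
  from-entering i (d ∷ D) m       _ _ (d∉ ∷ _) _ _ _ | inj₂ (refl , _) =
    ⊥-elim (All¬⇒¬Any d∉ (∈-++⁺ʳ D (here refl)))

  _≟ₚ_ : DecidableEquality Pt
  _≟ₚ_ = ≡-dec _≟_ _≟_

  -- Once the whole snake lies in G'_i with its tail at entry i, it fills G'_i (n distinct
  -- vertices); a further move inside G'_i must go onto the tail, closing a Hamiltonian cycle.
  closes-cycle : ∀ i x D {h} → let cf = x ∷ D ++ [ entry i ] in
    All (_∈ G' i) cf → length cf ≡ n → Unique cf → Linked EG cf →
    h ∈ G' i → Step x h → h ∉ x ∷ D → HasHamCycle (G' i)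
  closes-cycle i x D {h} cf⊆G len u lk h∈G st h∉ =
    x , D ++ [ entry i ] , subst (3 ≤_) (sym len) (s≤s (s≤s (s≤s z≤n))) , u , cf⊆G ,
    (λ _ → covers) , subst (Linked (GridEdge (G' i))) (sym (++-assoc (x ∷ D) [ entry i ] [ x ])) cycle
    where
    covers : ∀ {w} → w ∈ G' i → w ∈ x ∷ D ++ [ entry i ]
    covers = unique-covers _≟ₚ_ u cf⊆G (≤-reflexive (trans (length-G' i) (sym len)))
    h≡entry : h ≡ entry i
    h≡entry with ∈-++⁻ (x ∷ D) (covers h∈G)
    ... | inj₁ h∈ = ⊥-elim (h∉ h∈)
    ... | inj₂ (here e) = e
    cycle : Linked (GridEdge (G' i)) (x ∷ D ++ entry i ∷ [ x ])
    cycle = linked-join (x ∷ D) (linked-map (λ p q (_ , _ , a) → p , q , a) cf⊆G lk)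
      ((entry∈ i , All.head cf⊆G , subst (λ z → Adj z x) h≡entry (step⇒adj (step-sym st))) ∷ [-])

  advance : ∀ {cf cf′} → OneTransition VG EG n cf cf′ → Phase cf → Phase cf′ ⊎ HamSomewhere
  advance (_ , (_ , _ , _ , lk′) , h , refl , h∉) (on-track t≤y) =
    let vh , st = head-step _ (λ ()) lk′ in inj₁ (from-track t≤y vh st h∉)
  advance (_ , (_ , _ , _ , lk′) , h , refl , h∉) (at-gate i) =
    let vh , st = head-step _ (λ ()) lk′ in inj₁ (from-gate i refl vh st h∉)
  advance ((len , _ , u , _) , (_ , _ , _ , lk′) , h , refl , h∉) (entering i [] m D⊆G) =
    let vh , st = head-step _ (λ ()) lk′ in inj₁ (from-entering i [] m D⊆G len u vh st h∉)
  advance ((len , _ , u , _) , (_ , _ , _ , lk′) , h , refl , h∉) (entering i (d ∷ D) m D⊆G) =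
    let vh , st = head-step _ (++-∷≢[] D) lk′ in inj₁ (from-entering i (d ∷ D) m D⊆G len u vh st h∉)
  advance ((() , _) , _) (inside i [] _)
  advance ((len , _ , u , lk) , (_ , _ , _ , lk′) , h , refl , h∉) (inside i (x ∷ D) D⊆G)
    with head-step (D ++ _) (++-∷≢[] D) lk′
  ... | vh , st with copy-neighbour (All.head D⊆G) vh st
  ...   | inj₁ h∈G = inj₂ (i , T.ham-untranslate i
          (closes-cycle i x D (All-++⁺ D⊆G (entry∈ i ∷ [])) len u lk h∈G st
            (λ h∈ → h∉ (subst (h ∈_) (sym (dropLast-snoc (x ∷ D) (entry i))) h∈))))
  ...   | inj₂ (refl , _) = ⊥-elim (All¬⇒¬Any (AllPairs.head u) (∈-++⁺ʳ D (here refl)))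

  reach : ∀ {cf cf′} → YesInstance VG EG n cf cf′ → Phase cf → Phase cf′ ⊎ HamSomewhere
  reach [ move ]⁺       ph = advance move ph
  reach (move ∷⁺ moves) ph with advance move ph
  ... | inj₁ ph′ = reach moves ph′
  ... | inj₂ ham = inj₂ ham

  -- Yes-instance ⇒ Hamiltonian cycle: fin is not in any phase, so some move closed a cycle.
  converse : IsYes → HamSomewhere
  converse moves with reach moves (subst Phase (sym init≡seg) (on-track ≤-refl))
  ... | inj₁ ph  = ⊥-elim (fin-unreachable ph)
  ... | inj₂ ham = ham

  record EntryCycle (i : Fin (suc s)) : Set where
    field
      ws      : List Pt
      unique  : Unique (entry i ∷ ws)
      in-copy : All (_∈ G' i) ws
      closed  : Linked Adj (entry i ∷ ws ++ [ entry i ])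
      long    : track ≤ length ws

  covering-long : ∀ i {zs} → (∀ w → w ∈ G' i → w ∈ zs) → n ≤ length zs
  covering-long i covers =
    subst (_≤ _) (length-G' i) (unique-length≤ (T.unique-translate i (proj₁ (hyp i))) (All.tabulate (covers _)))

  from-entry : ∀ i → HasHamCycle (G' i) → EntryCycle i
  from-entry i (x , xs , _ , u , inG , covers , cycle) with ∈-∃++ (covers (entry i) (entry∈ i))
  ... | [] , Q , refl = record
    { ws = Q ; unique = u ; in-copy = All.tail inG ; closed = Linked.map (proj₂ ∘ proj₂) cycle
    ; long = ≤-pred (covering-long i covers) }
  ... | a ∷ P , Q , refl with All-++⁻ (a ∷ P) inG
  ...   | aP⊆G , _ ∷ Q⊆G = record
    { ws = Q ++ a ∷ P ; unique = unique-rotate (a ∷ P) u ; in-copy = All-++⁺ Q⊆G aP⊆G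
    ; closed = subst (λ zs → Linked Adj (entry i ∷ zs)) (sym (++-assoc Q (a ∷ P) [ entry i ]))
                 (rotate-closed a P Q (subst (Linked Adj) (++-assoc (a ∷ P) (entry i ∷ Q) [ a ])
                                         (Linked.map (proj₂ ∘ proj₂) cycle)))
    ; long = ≤-pred (subst (n ≤_) (length-++-comm (a ∷ P) (entry i ∷ Q)) (covering-long i covers)) }

  seg-rows : ∀ y m → All (λ p → proj₁ p ≡ track) (seg y m)
  seg-rows y zero    = []
  seg-rows y (suc m) = refl ∷ seg-rows (y ∸ 1) m

  seg-cols : ∀ y m → All (λ p → proj₂ p ≤ y) (seg y m)
  seg-cols y zero    = []
  seg-cols y (suc m) = ≤-refl ∷ All.map (λ le → ≤-trans le (m∸n≤m y 1)) (seg-cols (y ∸ 1) m)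

  seg-unique : ∀ y m → m ≤ suc y → Unique (seg y m)
  seg-unique y       zero          _        = []
  seg-unique y       (suc zero)    _        = [] ∷ []
  seg-unique (suc y) (suc (suc m)) (s≤s m≤) =
    All.map (λ le e → 1+n≰n (subst (λ q → proj₂ q ≤ y) (sym e) le)) (seg-cols y (suc m))
    ∷ seg-unique y (suc m) m≤

  seg-linked : ∀ y m → m ≤ suc y → Linked Adj (seg y m)
  seg-linked y       zero          _        = []
  seg-linked y       (suc zero)    _        = [-]
  seg-linked (suc y) (suc (suc m)) (s≤s m≤) = step⇒adj (west {track} {y}) ∷ seg-linked y (suc m) m≤

  seg-in-G : ∀ i y m → y ≤ c i → All VG (seg y m)
  seg-in-G i y zero    _   = []
  seg-in-G i y (suc m) y≤c = track∈ i y≤c ∷ seg-in-G i (y ∸ 1) m (≤-trans (m∸n≤m y 1) y≤c)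

  seg-++ : ∀ y m m′ → seg y (m + m′) ≡ seg y m ++ seg (y ∸ m) m′
  seg-++ y zero    m′ = refl
  seg-++ y (suc m) m′ = cong ((track , y) ∷_)
    (trans (seg-++ (y ∸ 1) m m′) (cong (λ z → seg (y ∸ 1) m ++ seg z m′) (∸-+-assoc y 1 m)))

  rightward : ℕ → ℕ → List Pt
  rightward y m = applyUpTo (λ t → (track , t + y)) m

  rightward-unique : ∀ y m → Unique (rightward y m)
  rightward-unique y m =
    Unique.applyUpTo⁺₁ (λ t → (track , t + y)) m (λ t<u _ e → <⇒≢ t<u (+-cancelʳ-≡ _ _ _ (cong proj₂ e)))

  rightward-linked : ∀ y m → Linked Adj (rightward y m)
  rightward-linked y m = Linked-applyUpTo⁺₂ _ m (λ t → step⇒adj (east {track} {t + y}))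

  rightward-rows : ∀ y m → All (λ p → proj₁ p ≡ track) (rightward y m)
  rightward-rows y m = All-applyUpTo⁺₂ (λ t → (track , t + y)) m (λ _ → refl)

  rightward-in-G : ∀ i y m → m + y ≤ suc (c i) → All VG (rightward y m)
  rightward-in-G i y m m+y≤ =
    All-applyUpTo⁺₁ (λ t → (track , t + y)) m (λ t<m → track∈ i (≤-pred (≤-trans (+-monoˡ-≤ y t<m) m+y≤)))

  column : List Pt
  column = applyUpTo (λ x → (x , exit)) track

  fin≡column : fin ≡ column ++ [ (track , exit) ]
  fin≡column = trans (map-upTo _ n) (sym (applyUpTo-∷ʳ (λ x → (x , exit)) track))

  column-unique : Unique column
  column-unique = Unique.applyUpTo⁺₁ (λ x → (x , exit)) track (λ x<y _ e → <⇒≢ x<y (cong proj₁ e))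

  column-linked : Linked Adj (column ++ [ (track , exit) ])
  column-linked = subst (Linked Adj) (sym (applyUpTo-∷ʳ (λ x → (x , exit)) track))
    (Linked-applyUpTo⁺₂ (λ x → (x , exit)) n (λ x → step⇒adj (south {x} {exit})))

  column-rows : All (λ p → proj₁ p < track) column
  column-rows = All-applyUpTo⁺₁ (λ x → (x , exit)) track (λ x<track → x<track)

  column-in-G : All VG column
  column-in-G = All-applyUpTo⁺₁ (λ x → (x , exit)) track (λ x<track → exit∈ (≤-trans x<track (n≤1+n _)))

  off-row : ∀ {x : Pt} {r xs} → proj₁ x ≢ r → All (λ p → proj₁ p ≡ r) xs → All (x ≢_) xs
  off-row x∉r = All.map (λ p∈r x≡p → x∉r (trans (cong proj₁ x≡p) p∈r))

  take-++-∷ : ∀ (xs : List Pt) {y ys} → take (suc (length xs)) (xs ++ y ∷ ys) ≡ xs ++ [ y ]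
  take-++-∷ []       = refl
  take-++-∷ (x ∷ xs) = cong (x ∷_) (take-++-∷ xs)

  open Sliding VG EG track

  -- The tour for a Hamiltonian cycle of G'_i, listed from the last head position back to
  -- init: the exit column, the track up to the gate, around the cycle from the entry, and
  -- back along the track leftwards to column 0.  Read backwards, the snake starts on the
  -- track, runs right to the gate, goes around the cycle (n vertices, so it never meets
  -- its own tail), returns to the track and runs left and up the exit column into fin.
  module Tour (i : Fin (suc s)) (cyc : EntryCycle i) where
    open EntryCycle cyc

    -- the track cells from the exit column to the gate are (track , t + exit), t ≤ d
    d : ℕ
    d = c i ∸ exit

    d+exit : d + exit ≡ c i
    d+exit = m∸n+n≡m (≤-trans (m≤n+m exit 3) (c≥ i))

    leftward back approach tour : List Pt
    leftward = seg (c i) (suc (c i))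
    back     = entry i ∷ gate i ∷ leftward
    approach = column ++ rightward exit (suc d)
    tour     = column ++ rightward exit (suc d) ++ gate i ∷ entry i ∷ ws ++ back

    tour-linked : Linked Adj tour
    tour-linked = linked-join column column-linked
      (subst (λ zs → Linked Adj (zs ++ gate i ∷ entry i ∷ ws ++ back)) (sym rightward-snoc)
        (subst (Linked Adj) (sym (++-assoc (rightward exit d) [ (track , c i) ] _))
          (linked-join (rightward exit d)
            (subst (Linked Adj) rightward-snoc (rightward-linked exit (suc d)))
            (step⇒adj (south {track} {c i}) ∷ step⇒adj (south {n} {c i}) ∷
             linked-join (entry i ∷ ws) closed back-linked))))
      where
      rightward-snoc : rightward exit (suc d) ≡ rightward exit d ++ [ (track , c i) ]
      rightward-snoc = trans (sym (applyUpTo-∷ʳ (λ t → (track , t + exit)) d))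
                             (cong (λ z → rightward exit d ++ [ (track , z) ]) d+exit)
      back-linked : Linked Adj back
      back-linked = step⇒adj (north {n} {c i}) ∷ step⇒adj (north {track} {c i}) ∷
                    seg-linked (c i) (suc (c i)) ≤-refl

    tour-in-G : All VG tour
    tour-in-G = All-++⁺ column-in-G (All-++⁺ (rightward-in-G i exit (suc d) (s≤s (≤-reflexive d+exit)))
      (gate∈ i ∷ G'∈ (entry∈ i) ∷ All-++⁺ (All.map G'∈ in-copy)
        (G'∈ (entry∈ i) ∷ gate∈ i ∷ seg-in-G i (c i) (suc (c i)) ≤-refl)))

    entry∉ws : entry i ∉ ws
    entry∉ws = All¬⇒¬Any (AllPairs.head unique)

    back-unique : Unique back
    back-unique = ((λ ()) ∷ off-row (λ ()) (seg-rows (c i) (suc (c i))))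
                ∷ off-row (λ ()) (seg-rows (c i) (suc (c i)))
                ∷ seg-unique (c i) (suc (c i)) ≤-refl

    ws-apart : ∀ {w} → w ∈ ws → w ∉ back
    ws-apart w∈ (here refl)         = entry∉ws w∈
    ws-apart w∈ (there (here refl)) = 1+n≰n (G'-row (All.lookup in-copy w∈))
    ws-apart w∈ (there (there p))   =
      1+n≰n (≤-trans (n≤1+n _) (≤-trans (G'-row (All.lookup in-copy w∈))
                                        (≤-reflexive (All.lookup (seg-rows (c i) (suc (c i))) p))))

    deep : ∀ {z} → z ∈ gate i ∷ entry i ∷ ws → n ≤ proj₁ z
    deep (here refl)          = ≤-refl
    deep (there (here refl))  = n≤1+n n
    deep (there (there w∈))   = ≤-trans (n≤1+n n) (G'-row (All.lookup in-copy w∈))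

    approach-unique : Unique approach
    approach-unique = AllPairsₚ.++⁺ column-unique (rightward-unique exit (suc d))
      (All.map (λ x<track → off-row (<⇒≢ x<track) (rightward-rows exit (suc d))) column-rows)

    approach-rows : All (λ p → proj₁ p ≤ track) approach
    approach-rows = All-++⁺ (All.map <⇒≤ column-rows) (All.map ≤-reflexive (rightward-rows exit (suc d)))

    -- every cell differs from the track (= n - 1) cells visited just before it: the only
    -- repetitions (entry, gate, track cells) are separated by the whole cycle
    tour-spread : Spread tour
    tour-spread = subst Spread (++-assoc column (rightward exit (suc d)) _)
     (spread-++ approach approach-unique (All.map high approach-rows)
      ((λ p → gate∉ (∈-take-++ˡ track (entry i ∷ ws) back (≤-trans long (n≤1+n _)) p)) ,
       (λ p → entry∉ws (∈-take-++ˡ track ws back long p)) ,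
       spread-++ ws (AllPairs.tail unique) (All.tabulate (λ w∈ p → ws-apart w∈ (∈-take track back p)))
         (unique⇒spread back-unique)))
      where
      window : List Pt
      window = gate i ∷ entry i ∷ ws
      high : ∀ {a} → proj₁ a ≤ track → a ∉ take track (window ++ back)
      high a≤track p =
        1+n≰n (≤-trans (deep (∈-take-++ˡ track window back (≤-trans long (≤-trans (n≤1+n _) (n≤1+n _))) p)) a≤track)
      gate∉ : gate i ∉ entry i ∷ ws
      gate∉ (here ())
      gate∉ (there w∈) = 1+n≰n (G'-row (All.lookup in-copy w∈))

    pre-init : List Pt
    pre-init = seg (c i) (c i ∸ track)

    leftward≡ : leftward ≡ pre-init ++ init
    leftward≡ = begin
      seg (c i) (suc (c i))                    ≡⟨ cong (seg (c i)) (sym cells) ⟩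
      seg (c i) (c i ∸ track + n)              ≡⟨ seg-++ (c i) (c i ∸ track) n ⟩
      pre-init ++ seg (c i ∸ (c i ∸ track)) n  ≡⟨ cong (λ y → pre-init ++ seg y n) (m∸[m∸n]≡n track≤c) ⟩
      pre-init ++ seg track n                  ≡⟨ cong (pre-init ++_) init≡seg ⟨
      pre-init ++ init                         ∎
      where
      open ≡-Reasoning
      track≤c : track ≤ c i
      track≤c = ≤-trans (m≤n+m track 2) (c≥ i)
      cells : c i ∸ track + n ≡ suc (c i)
      cells = trans (+-suc (c i ∸ track) track) (cong suc (m∸n+n≡m track≤c))

    prefix : List Pt
    prefix = column ++ rightward exit (suc d) ++ gate i ∷ entry i ∷ ws ++ entry i ∷ gate i ∷ pre-init

    tour≡ : tour ≡ prefix ++ init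
    tour≡ = trans
      (cong (λ z → column ++ rightward exit (suc d) ++ gate i ∷ entry i ∷ ws ++ entry i ∷ gate i ∷ z) leftward≡)
      (sym (trans (++-assoc column _ init) (cong (column ++_) (trans (++-assoc (rightward exit (suc d)) _ init)
        (cong (λ z → rightward exit (suc d) ++ gate i ∷ entry i ∷ z) (++-assoc ws _ init))))))

    take-tour : take n tour ≡ fin
    take-tour = trans (subst (λ m → take (suc m) tour ≡ column ++ [ (track , exit) ])
                             (length-applyUpTo (λ x → (x , exit)) track) (take-++-∷ column))
                      (sym fin≡column)

    length-init : length init ≡ n
    length-init = trans (length-map _ (downFrom n)) (length-downFrom n)

    tour-yes : IsYes
    tour-yes = subst₂ (YesInstance VG EG n) (take-all n init (≤-reflexive length-init))
      (trans (cong (take n) (sym tour≡)) take-tour)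
      (slide prefix init (λ ()) (≤-reflexive (sym length-init))
        (subst SlideWalk tour≡
          (tour-in-G , linked-map (λ p q a → p , q , a) tour-in-G tour-linked , tour-spread)))

  forward : HamSomewhere → IsYes
  forward (i , ham) = Tour.tour-yes i (from-entry i (T.ham-translate i ham))

lemma4p10 : (n t : ℕ) → 3 ≤ n → 1 ≤ t
    → (Gs : Fin t → List Pt)
    → (∀ i → Unique (Gs i) × length (Gs i) ≡ n × Connected (Gs i))
    → (c : Fin t → ℕ)
    → (∀ i → (suc n , c i) ∈ HamToSna.G' n t Gs c i)
    → (∃[ i ] HasHamCycle (Gs i)) ⇔ HamToSna.IsYes n t Gs c
lemma4p10 (suc (suc (suc k))) (suc s) (s≤s (s≤s (s≤s _))) (s≤s _) Gs hyp c entry∈ =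
  mk⇔ forward converse
  where open Construction k s Gs hyp c entry∈
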